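{- For every positive integer $n$ with $n \equiv 0 \pmod 4$ or $n \equiv 1 \pmod 4$, the maximum number of chains in a chain--collider--fork decomposition of the transitive tournament $TT_n$ is $\frac{n}{4}(n-2)$ when $n$ is even, and $\frac{(n-1)^2}{4}$ when $n$ is odd.
   Context: The transitive tournament $TT_n$ has vertex set $\{v_1,\dots,v_n\}$ and arc set $\{(v_i,v_j): 1\le i<j\le n\}$ (an arc $(u,v)$ is written $u\to v$). A chain is a digraph on three distinct vertices with arcs $a\to b\to c$; a collider is one with arcs $a\to b\leftarrow c$; a fork is one with arcs $a\leftarrow b\to c$. A chain--collider--fork decomposition of $TT_n$ is a partition of the arc set of $TT_n$ into two-element sets of arcs, each of which forms (as a subdigraph) a chain, a collider, or a fork. -}

module Defs where

open import Data.Nat using (ℕ)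
open import Data.Fin using (Fin; _<_; _≟_)
open import Data.Product using (_×_; _,_; proj₁; proj₂)
open import Data.Sum using (_⊎_)
open import Data.List using (List; []; _∷_; concatMap; length; filter)
open import Data.List.Relation.Unary.All using (All)
open import Data.List.Relation.Unary.Unique.Propositional using (Unique)
open import Data.List.Membership.Propositional using (_∈_)
open import Relation.Binary.PropositionalEquality using (_≡_; _≢_)
open import Relation.Nullary using (Dec; yes; no)
open import Relation.Nullary.Decidable using (_⊎-dec_)

-- A (candidate) arc u → v on the vertex set {v_1,…,v_n}, represented by Fin n
-- (vertex v_{i+1} is the element i).
Arc : ℕ → Set
Arc n = Fin n × Fin n

tail head : ∀ {n} → Arc n → Fin n
tail = proj₁
head = proj₂

IsArcTT : ∀ {n} → Arc n → Set
IsArcTT (i , j) = i < j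

Block : ℕ → Set
Block n = Arc n × Arc n

ChainShape : ∀ {n} → Arc n → Arc n → Set
ChainShape (a , b) (b' , c) = b ≡ b' × a ≢ b × b ≢ c × a ≢ c

IsChain : ∀ {n} → Block n → Set
IsChain (e , f) = ChainShape e f ⊎ ChainShape f e

IsCollider : ∀ {n} → Block n → Set
IsCollider ((a , b) , (c , b')) = b ≡ b' × a ≢ b × c ≢ b × a ≢ c

IsFork : ∀ {n} → Block n → Set
IsFork ((b , a) , (b' , c)) = b ≡ b' × a ≢ b × c ≢ b × a ≢ c

IsCCF : ∀ {n} → Block n → Set
IsCCF B = IsChain B ⊎ IsCollider B ⊎ IsFork B

arcsOf : ∀ {n} → List (Block n) → List (Arc n)
arcsOf = concatMap (λ B → proj₁ B ∷ proj₂ B ∷ [])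

record CCFDecomposition (n : ℕ) : Set where
  field
    blocks   : List (Block n)
    shape    : All IsCCF blocks
    valid    : All IsArcTT (arcsOf blocks)
    distinct : Unique (arcsOf blocks)
    cover    : ∀ (i j : Fin n) → i < j → (i , j) ∈ arcsOf blocks

open import Data.Empty

open import Data.Empty using (⊥)
open import Relation.Nullary.Decidable using (_×-dec_) renaming (¬? to not?)

chainShape? : ∀ {n} (e f : Arc n) → Dec (ChainShape e f)
chainShape? (a , b) (b' , c) =
  (b ≟ b') ×-dec (not? (a ≟ b) ×-dec (not? (b ≟ c) ×-dec not? (a ≟ c)))

isChain? : ∀ {n} (B : Block n) → Dec (IsChain B)
isChain? (e , f) = chainShape? e f ⊎-dec chainShape? f e

numChains : ∀ {n} → CCFDecomposition n → ℕ
numChains D = length (filter isChain? (CCFDecomposition.blocks D))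

{-# OPTIONS --safe #-}
-- Upper bound: fix a cut s and give an arc weight 1 when its two ends lie on the same side of the cut.
-- The middle vertex b of a chain a → b → c lies on one side, so one of the arcs a → b, b → c weighs 1;
-- hence every decomposition has at most as many chains as the total weight of the arcs of TT_n, which
-- does not depend on the decomposition. A decomposition in which no block weighs more than its chain
-- indicator ("tight") therefore has the maximum number of chains.
-- Construction: TT_{n+4} arises from TT_n by adding two vertices below and two above. Every old vertex
-- x is the middle of the chains bot₀ → x → top₀ and bot₁ → x → top₁, and the six arcs among the new
-- vertices form two chains and a collider. Moving the cut up by two keeps the decomposition tight and
-- adds 2n + 2 chains; starting from TT_0 and TT_1 this gives the two closed forms.

module Submission where

open import Defs
open import Data.Bool using (Bool; true; false; not)
open import Data.Nat using (ℕ; zero; suc; _≤_; _+_; _*_; _∸_; _/_; _%_; z≤n; s≤s; s≤s⁻¹; s<s; s<s⁻¹; _<ᵇ_)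
import Data.Nat as ℕ
open import Data.Nat.Properties
  using (module ≤-Reasoning; ≤-trans; ≤-reflexive; +-assoc; +-comm; +-identityʳ; +-mono-≤; +-monoʳ-≤;
         m≤m+n; m≤n+m; n<1+n; m≤n⇒m≤1+n; n≮0; *-distribˡ-∸; m+n∸n≡m; +-cancelʳ-≡)
open import Data.Nat.DivMod using (m*n/n≡m; m≡m%n+[m/n]*n; m<n⇒m%n≡m; m∣n⇒o%n%m≡o%m)
open import Data.Nat.Divisibility using (divides)
open import Data.Nat.ListAction using (sum)
open import Data.Nat.ListAction.Properties using (sum-++; sum-↭)
open import Data.Nat.Tactic.RingSolver using (solve-∀)
open import Data.Fin using (Fin; zero; suc; toℕ; fromℕ; inject₁; _<_)
open import Data.Fin.Properties
  using (suc-injective; inject₁-injective; toℕ-inject₁; toℕ-fromℕ; toℕ<n; <⇒≢; <-asym; <-irrefl; <-trans)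
import Data.Fin.Relation.Unary.Top as Top
open import Data.Sum using (_⊎_; inj₁; inj₂; [_,_])
import Data.Sum as Sum
open import Data.Product using (_×_; Σ; _,_; proj₁; proj₂)
open import Data.List using (List; []; _∷_; _++_; map; length; filter; allFin)
open import Data.List.Properties using (map-++; map-∘; map-cong; length-tabulate)
open import Data.List.Relation.Unary.All as All using (All; []; _∷_)
import Data.List.Relation.Unary.All.Properties as AllP
open import Data.List.Relation.Unary.AllPairs using ([]; _∷_)
open import Data.List.Relation.Unary.Any using (here; there)
open import Data.List.Relation.Unary.Unique.Propositional using (Unique)
import Data.List.Relation.Unary.Unique.Propositional.Properties as UniqueP
open import Data.List.Relation.Binary.Disjoint.Propositional using (Disjoint)
open import Data.List.Relation.Binary.Permutation.Propositional.Properties using (shift; map⁺)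
open import Data.List.Membership.Propositional using (_∈_)
open import Data.List.Membership.Propositional.Properties
  using (∈-∃++; ∈-++⁻; ∈-++⁺ˡ; ∈-++⁺ʳ; ∈-map⁻; ∈-map⁺; ∈-allFin)
open import Data.Empty using (⊥-elim)
open import Function using (_⇔_; mk⇔; _∘_; id)
open import Relation.Binary.PropositionalEquality
  using (_≡_; _≢_; refl; sym; trans; cong; cong₂; subst; subst₂; module ≡-Reasoning)
open import Relation.Nullary using (¬_; Dec; does; yes; no)
open import Relation.Nullary.Decidable using (dec-true; dec-false; does-⇔)
open import Relation.Unary using (Pred; Decidable)

indicator : Bool → ℕ
indicator false = 0
indicator true  = 1

length-filter≡sum-indicator : ∀ {a p} {A : Set a} {P : Pred A p} (P? : Decidable P) xs →
                              length (filter P? xs) ≡ sum (map (λ x → indicator (does (P? x))) xs)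
length-filter≡sum-indicator P? [] = refl
length-filter≡sum-indicator P? (x ∷ xs) with does (P? x)
... | true  = cong suc (length-filter≡sum-indicator P? xs)
... | false = length-filter≡sum-indicator P? xs

sum-map-mono-≤ : ∀ {a} {A : Set a} {f g : A → ℕ} {xs} →
                 All (λ x → f x ≤ g x) xs → sum (map f xs) ≤ sum (map g xs)
sum-map-mono-≤ []       = z≤n
sum-map-mono-≤ (p ∷ ps) = +-mono-≤ p (sum-map-mono-≤ ps)

sum-map-⊆ : ∀ {a} {A : Set a} (f : A → ℕ) {xs ys} → Unique xs →
            (∀ {x} → x ∈ xs → x ∈ ys) → sum (map f xs) ≤ sum (map f ys)
sum-map-⊆ f {[]}     _            _     = z≤n
sum-map-⊆ f {x ∷ xs} (x∉xs ∷ xs!) xs⊆ys with ∈-∃++ (xs⊆ys (here refl))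
... | ys₁ , ys₂ , refl =
  subst (f x + sum (map f xs) ≤_) (sym (sum-↭ (map⁺ f (shift x ys₁ ys₂))))
    (+-monoʳ-≤ (f x) (sum-map-⊆ f xs! xs⊆ys₁++ys₂))
  where
    xs⊆ys₁++ys₂ : ∀ {y} → y ∈ xs → y ∈ ys₁ ++ ys₂
    xs⊆ys₁++ys₂ y∈xs with ∈-++⁻ ys₁ (xs⊆ys (there y∈xs))
    ... | inj₁ y∈ys₁         = ∈-++⁺ˡ y∈ys₁
    ... | inj₂ (here refl)   = ⊥-elim (All.lookup x∉xs y∈xs refl)
    ... | inj₂ (there y∈ys₂) = ∈-++⁺ʳ ys₁ y∈ys₂

open CCFDecomposition

chainIndicator : ∀ {n} → Block n → ℕ
chainIndicator B = indicator (does (isChain? B))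

chainIndicator-chain : ∀ {n} {B : Block n} → IsChain B → chainIndicator B ≡ 1
chainIndicator-chain {B = B} chain = cong indicator (dec-true (isChain? B) chain)

chainIndicator-nonchain : ∀ {n} {B : Block n} → ¬ IsChain B → chainIndicator B ≡ 0
chainIndicator-nonchain {B = B} nonchain = cong indicator (dec-false (isChain? B) nonchain)

numChains≡sum-chainIndicator : ∀ {n} (D : CCFDecomposition n) → numChains D ≡ sum (map chainIndicator (blocks D))
numChains≡sum-chainIndicator D = length-filter≡sum-indicator isChain? (blocks D)

below : ∀ {n} → ℕ → Fin n → Bool
below s v = toℕ v <ᵇ s

-- For an arc i → j with i < j: 1 if it lies on one side of the cut at s, 0 if it crosses the cut.
weight : ∀ {n} → ℕ → Arc n → ℕ
weight s (i , j) = indicator (below s j) + indicator (not (below s i))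

blockWeight : ∀ {n} → ℕ → Block n → ℕ
blockWeight s (e , f) = weight s e + weight s f

indicator+indicator-not : ∀ b → indicator b + indicator (not b) ≡ 1
indicator+indicator-not false = refl
indicator+indicator-not true  = refl

1≤weight-path : ∀ {n} s (a b c : Fin n) → 1 ≤ weight s (a , b) + weight s (b , c)
1≤weight-path s a b c = subst (_≤ weight s (a , b) + weight s (b , c)) (indicator+indicator-not (below s b))
  (+-mono-≤ (m≤m+n (indicator (below s b)) _) (m≤n+m (indicator (not (below s b))) _))

chainIndicator≤blockWeight : ∀ {n} s (B : Block n) → chainIndicator B ≤ blockWeight s B
chainIndicator≤blockWeight s B = bound B (isChain? B)
  where
    bound : ∀ B → (chain? : Dec (IsChain B)) → indicator (does chain?) ≤ blockWeight s B
    bound _                    (no _)                 = z≤n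
    bound ((a , b) , (_ , c)) (yes (inj₁ (refl , _))) = 1≤weight-path s a b c
    bound ((b , c) , (a , _)) (yes (inj₂ (refl , _))) =
      subst (1 ≤_) (+-comm (weight s (a , b)) _) (1≤weight-path s a b c)

sum-weight-arcsOf : ∀ {n} s (bs : List (Block n)) →
                    sum (map (weight s) (arcsOf bs)) ≡ sum (map (blockWeight s) bs)
sum-weight-arcsOf s []             = refl
sum-weight-arcsOf s ((e , f) ∷ bs) =
  trans (cong (λ r → weight s e + (weight s f + r)) (sum-weight-arcsOf s bs))
        (sym (+-assoc (weight s e) _ _))

Tight : ∀ {n} → ℕ → CCFDecomposition n → Set
Tight s D = All (λ B → blockWeight s B ≤ chainIndicator B) (blocks D)

tight⇒maximal : ∀ {n s} {D₀ : CCFDecomposition n} → Tight s D₀ → (D : CCFDecomposition n) →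
                numChains D ≤ numChains D₀
tight⇒maximal {s = s} {D₀} tight D = begin
  numChains D                               ≡⟨ numChains≡sum-chainIndicator D ⟩
  sum (map chainIndicator (blocks D))       ≤⟨ sum-map-mono-≤ (All.universal (chainIndicator≤blockWeight s) (blocks D)) ⟩
  sum (map (blockWeight s) (blocks D))      ≡⟨ sum-weight-arcsOf s (blocks D) ⟨
  sum (map (weight s) (arcsOf (blocks D)))  ≤⟨ sum-map-⊆ (weight s) (distinct D) arcs⊆arcs₀ ⟩
  sum (map (weight s) (arcsOf (blocks D₀))) ≡⟨ sum-weight-arcsOf s (blocks D₀) ⟩
  sum (map (blockWeight s) (blocks D₀))     ≤⟨ sum-map-mono-≤ tight ⟩
  sum (map chainIndicator (blocks D₀))      ≡⟨ numChains≡sum-chainIndicator D₀ ⟨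
  numChains D₀                              ∎
  where
    open ≤-Reasoning
    arcs⊆arcs₀ : ∀ {e} → e ∈ arcsOf (blocks D) → e ∈ arcsOf (blocks D₀)
    arcs⊆arcs₀ {i , j} e∈D = cover D₀ i j (All.lookup (valid D) e∈D)

mapArc : ∀ {m n} → (Fin m → Fin n) → Arc m → Arc n
mapArc f (i , j) = f i , f j

mapBlock : ∀ {m n} → (Fin m → Fin n) → Block m → Block n
mapBlock f (e , e′) = mapArc f e , mapArc f e′

arcsOf-map : ∀ {m n} (f : Fin m → Fin n) bs → arcsOf (map (mapBlock f) bs) ≡ map (mapArc f) (arcsOf bs)
arcsOf-map f []             = refl
arcsOf-map f ((e , e′) ∷ bs) = cong (λ as → mapArc f e ∷ mapArc f e′ ∷ as) (arcsOf-map f bs)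

arcsOf-++ : ∀ {n} (bs bs′ : List (Block n)) → arcsOf (bs ++ bs′) ≡ arcsOf bs ++ arcsOf bs′
arcsOf-++ []             bs′ = refl
arcsOf-++ ((e , e′) ∷ bs) bs′ = cong (λ as → e ∷ e′ ∷ as) (arcsOf-++ bs bs′)

∈-arcsOf₁ : ∀ {n} {B : Block n} {bs} → B ∈ bs → proj₁ B ∈ arcsOf bs
∈-arcsOf₁ (here refl) = here refl
∈-arcsOf₁ (there B∈bs) = there (there (∈-arcsOf₁ B∈bs))

∈-arcsOf₂ : ∀ {n} {B : Block n} {bs} → B ∈ bs → proj₂ B ∈ arcsOf bs
∈-arcsOf₂ (here refl) = there (here refl)
∈-arcsOf₂ (there B∈bs) = there (there (∈-arcsOf₂ B∈bs))

module _ {m n} {f : Fin m → Fin n} (f-injective : ∀ {x y} → f x ≡ f y → x ≡ y) where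

  private
    ≢-map : ∀ {x y} → x ≢ y → f x ≢ f y
    ≢-map x≢y fx≡fy = x≢y (f-injective fx≡fy)

    ≢-unmap : ∀ {x y} → f x ≢ f y → x ≢ y
    ≢-unmap fx≢fy x≡y = fx≢fy (cong f x≡y)

  chainShape-map : ∀ {e e′} → ChainShape e e′ → ChainShape (mapArc f e) (mapArc f e′)
  chainShape-map (refl , a≢b , b≢c , a≢c) = refl , ≢-map a≢b , ≢-map b≢c , ≢-map a≢c

  chainShape-unmap : ∀ {e e′} → ChainShape (mapArc f e) (mapArc f e′) → ChainShape e e′
  chainShape-unmap (fb≡fb′ , a≢b , b≢c , a≢c) = f-injective fb≡fb′ , ≢-unmap a≢b , ≢-unmap b≢c , ≢-unmap a≢c

  isChain-map⇔ : ∀ {B} → IsChain (mapBlock f B) ⇔ IsChain B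
  isChain-map⇔ = mk⇔ (Sum.map chainShape-unmap chainShape-unmap) (Sum.map chainShape-map chainShape-map)

  chainIndicator-map : ∀ B → chainIndicator (mapBlock f B) ≡ chainIndicator B
  chainIndicator-map B = cong indicator (does-⇔ isChain-map⇔ (isChain? (mapBlock f B)) (isChain? B))

  isCCF-map : ∀ {B} → IsCCF B → IsCCF (mapBlock f B)
  isCCF-map (inj₁ chain) = inj₁ (Sum.map chainShape-map chainShape-map chain)
  isCCF-map (inj₂ (inj₁ (refl , a≢b , c≢b , a≢c))) = inj₂ (inj₁ (refl , ≢-map a≢b , ≢-map c≢b , ≢-map a≢c))
  isCCF-map (inj₂ (inj₂ (refl , a≢b , c≢b , a≢c))) = inj₂ (inj₂ (refl , ≢-map a≢b , ≢-map c≢b , ≢-map a≢c))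

m≤n⇒n<ᵇm≡false : ∀ {m n} → m ≤ n → (n <ᵇ m) ≡ false
m≤n⇒n<ᵇm≡false z≤n       = refl
m≤n⇒n<ᵇm≡false (s≤s m≤n) = m≤n⇒n<ᵇm≡false m≤n

module Extension (n : ℕ) where

  V : Set
  V = Fin (4 + n)

  bot₀ bot₁ top₀ top₁ : V
  bot₀ = zero
  bot₁ = suc zero
  top₀ = suc (suc (inject₁ (fromℕ n)))
  top₁ = fromℕ (3 + n)

  lift : Fin n → V
  lift x = suc (suc (inject₁ (inject₁ x)))

  toℕ-lift : ∀ x → toℕ (lift x) ≡ 2 + toℕ x
  toℕ-lift x = cong (2 +_) (trans (toℕ-inject₁ (inject₁ x)) (toℕ-inject₁ x))

  toℕ-top₀ : toℕ top₀ ≡ 2 + n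
  toℕ-top₀ = cong (2 +_) (trans (toℕ-inject₁ (fromℕ n)) (toℕ-fromℕ n))

  toℕ-top₁ : toℕ top₁ ≡ 3 + n
  toℕ-top₁ = toℕ-fromℕ (3 + n)

  lift-injective : ∀ {x y} → lift x ≡ lift y → x ≡ y
  lift-injective eq = inject₁-injective (inject₁-injective (suc-injective (suc-injective eq)))

  mapArc-lift-injective : ∀ {e e′} → mapArc lift e ≡ mapArc lift e′ → e ≡ e′
  mapArc-lift-injective {_ , _} {_ , _} eq =
    cong₂ _,_ (lift-injective (cong proj₁ eq)) (lift-injective (cong proj₂ eq))

  lift-mono : ∀ {x y} → x < y → lift x < lift y
  lift-mono {x} {y} x<y = subst₂ ℕ._<_ (sym (toℕ-lift x)) (sym (toℕ-lift y)) (s<s (s<s x<y))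

  lift-mono⁻¹ : ∀ {x y} → lift x < lift y → x < y
  lift-mono⁻¹ {x} {y} p = s<s⁻¹ (s<s⁻¹ (subst₂ ℕ._<_ (toℕ-lift x) (toℕ-lift y) p))

  lift<top₀ : ∀ x → lift x < top₀
  lift<top₀ x = subst₂ ℕ._<_ (sym (toℕ-lift x)) (sym toℕ-top₀) (s<s (s<s (toℕ<n x)))

  top₀<top₁ : top₀ < top₁
  top₀<top₁ = subst₂ ℕ._<_ (sym toℕ-top₀) (sym toℕ-top₁) (n<1+n (2 + n))

  lift<top₁ : ∀ x → lift x < top₁
  lift<top₁ x = <-trans (lift<top₀ x) top₀<top₁

  data Position : V → Set where
    isBot₀ : Position bot₀
    isBot₁ : Position bot₁
    isLift : ∀ x → Position (lift x)
    isTop₀ : Position top₀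
    isTop₁ : Position top₁

  position : ∀ v → Position v
  position zero          = isBot₀
  position (suc zero)    = isBot₁
  position (suc (suc v)) with Top.view v
  ... | Top.‵fromℕ = isTop₁
  ... | Top.‵inject₁ w with Top.view w
  ...   | Top.‵fromℕ    = isTop₀
  ...   | Top.‵inject₁ x = isLift x

  lift≢top₀ : ∀ x → lift x ≢ top₀
  lift≢top₀ x = <⇒≢ (lift<top₀ x)

  lift≢top₁ : ∀ x → lift x ≢ top₁
  lift≢top₁ x = <⇒≢ (lift<top₁ x)

  top₀≢top₁ : top₀ ≢ top₁
  top₀≢top₁ = <⇒≢ top₀<top₁

  chain₀ chain₁ : Fin n → Block (4 + n)
  chain₀ x = (bot₀ , lift x) , (lift x , top₀)
  chain₁ x = (bot₁ , lift x) , (lift x , top₁)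

  cornerChain₀ cornerChain₁ cornerCollider : Block (4 + n)
  cornerChain₀   = (bot₀ , bot₁) , (bot₁ , top₀)
  cornerChain₁   = (bot₀ , top₀) , (top₀ , top₁)
  cornerCollider = (bot₀ , top₁) , (bot₁ , top₁)

  corners : List (Block (4 + n))
  corners = cornerChain₀ ∷ cornerChain₁ ∷ cornerCollider ∷ []

  newBlocks : List (Fin n) → List (Block (4 + n))
  newBlocks []       = corners
  newBlocks (x ∷ xs) = chain₀ x ∷ chain₁ x ∷ newBlocks xs

  isChain-chain₀ : ∀ x → IsChain (chain₀ x)
  isChain-chain₀ x = inj₁ (refl , (λ ()) , lift≢top₀ x , (λ ()))

  isChain-chain₁ : ∀ x → IsChain (chain₁ x)
  isChain-chain₁ x = inj₁ (refl , (λ ()) , lift≢top₁ x , (λ ()))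

  isChain-cornerChain₀ : IsChain cornerChain₀
  isChain-cornerChain₀ = inj₁ (refl , (λ ()) , (λ ()) , (λ ()))

  isChain-cornerChain₁ : IsChain cornerChain₁
  isChain-cornerChain₁ = inj₁ (refl , (λ ()) , top₀≢top₁ , (λ ()))

  ¬isChain-cornerCollider : ¬ IsChain cornerCollider
  ¬isChain-cornerCollider (inj₁ (() , _))
  ¬isChain-cornerCollider (inj₂ (() , _))

  isCollider-cornerCollider : IsCollider cornerCollider
  isCollider-cornerCollider = refl , (λ ()) , (λ ()) , (λ ())

  shape-newBlocks : ∀ xs → All IsCCF (newBlocks xs)
  shape-newBlocks []       = inj₁ isChain-cornerChain₀ ∷ inj₁ isChain-cornerChain₁
                           ∷ inj₂ (inj₁ isCollider-cornerCollider) ∷ []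
  shape-newBlocks (x ∷ xs) = inj₁ (isChain-chain₀ x) ∷ inj₁ (isChain-chain₁ x) ∷ shape-newBlocks xs

  sum-chainIndicator-newBlocks : ∀ xs → sum (map chainIndicator (newBlocks xs)) ≡ length xs * 2 + 2
  sum-chainIndicator-newBlocks [] = cong₂ _+_ (chainIndicator-chain isChain-cornerChain₀)
    (cong₂ _+_ (chainIndicator-chain isChain-cornerChain₁)
               (cong (_+ 0) (chainIndicator-nonchain ¬isChain-cornerCollider)))
  sum-chainIndicator-newBlocks (x ∷ xs) = cong₂ _+_ (chainIndicator-chain (isChain-chain₀ x))
    (cong₂ _+_ (chainIndicator-chain (isChain-chain₁ x)) (sum-chainIndicator-newBlocks xs))

  valid-newBlocks : ∀ xs → All IsArcTT (arcsOf (newBlocks xs))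
  valid-newBlocks []       = s<s z≤n ∷ s<s (s<s z≤n) ∷ s<s z≤n ∷ top₀<top₁ ∷ s<s z≤n ∷ s<s (s<s z≤n) ∷ []
  valid-newBlocks (x ∷ xs) = s<s z≤n ∷ lift<top₀ x ∷ s<s (s<s z≤n) ∷ lift<top₁ x ∷ valid-newBlocks xs

  Avoids : Fin n → Arc (4 + n) → Set
  Avoids x e = tail e ≢ lift x × head e ≢ lift x

  avoids-newBlocks : ∀ {x} xs → All (x ≢_) xs → All (Avoids x) (arcsOf (newBlocks xs))
  avoids-newBlocks {x} [] [] =
    ((λ ()) , (λ ())) ∷ ((λ ()) , top₀≢lift) ∷ ((λ ()) , top₀≢lift)
    ∷ (top₀≢lift , top₁≢lift) ∷ ((λ ()) , top₁≢lift) ∷ ((λ ()) , top₁≢lift) ∷ []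
    where
      top₀≢lift : top₀ ≢ lift x
      top₀≢lift = lift≢top₀ x ∘ sym
      top₁≢lift : top₁ ≢ lift x
      top₁≢lift = lift≢top₁ x ∘ sym
  avoids-newBlocks {x} (y ∷ ys) (x≢y ∷ x∉ys) =
    ((λ ()) , ly≢lx) ∷ (ly≢lx , lift≢top₀ x ∘ sym) ∷ ((λ ()) , ly≢lx) ∷ (ly≢lx , lift≢top₁ x ∘ sym)
    ∷ avoids-newBlocks ys x∉ys
    where
      ly≢lx : lift y ≢ lift x
      ly≢lx eq = x≢y (sym (lift-injective eq))

  unique-newBlocks : ∀ xs → Unique xs → Unique (arcsOf (newBlocks xs))
  unique-newBlocks [] [] =
      ((λ ()) ∷ (λ ()) ∷ (λ ()) ∷ (λ ()) ∷ (λ ()) ∷ [])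
    ∷ ((λ ()) ∷ (λ ()) ∷ (λ ()) ∷ top₀≢top₁ ∘ cong head ∷ [])
    ∷ ((λ ()) ∷ top₀≢top₁ ∘ cong head ∷ (λ ()) ∷ [])
    ∷ ((λ ()) ∷ (λ ()) ∷ [])
    ∷ ((λ ()) ∷ [])
    ∷ [] ∷ []
  unique-newBlocks (x ∷ xs) (x∉xs ∷ xs!) =
      ((λ ()) ∷ (λ ()) ∷ (λ ()) ∷ All.map ≢-at-head avoids)
    ∷ ((λ ()) ∷ top₀≢top₁ ∘ cong head ∷ All.map ≢-at-tail avoids)
    ∷ ((λ ()) ∷ All.map ≢-at-head avoids)
    ∷ All.map ≢-at-tail avoids
    ∷ unique-newBlocks xs xs!
    where
      avoids = avoids-newBlocks xs x∉xs
      ≢-at-head : ∀ {a e} → Avoids x e → (a , lift x) ≢ e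
      ≢-at-head (_ , head≢) eq = head≢ (sym (cong head eq))
      ≢-at-tail : ∀ {b e} → Avoids x e → (lift x , b) ≢ e
      ≢-at-tail (tail≢ , _) eq = tail≢ (sym (cong tail eq))

  Outer : Arc (4 + n) → Set
  Outer e = (tail e ≡ bot₀ ⊎ tail e ≡ bot₁) ⊎ (head e ≡ top₀ ⊎ head e ≡ top₁)

  outer-newBlocks : ∀ xs → All Outer (arcsOf (newBlocks xs))
  outer-newBlocks []       = inj₁ (inj₁ refl) ∷ inj₁ (inj₂ refl) ∷ inj₁ (inj₁ refl)
                           ∷ inj₂ (inj₂ refl) ∷ inj₁ (inj₁ refl) ∷ inj₁ (inj₂ refl) ∷ []
  outer-newBlocks (x ∷ xs) = inj₁ (inj₁ refl) ∷ inj₂ (inj₁ refl) ∷ inj₁ (inj₂ refl) ∷ inj₂ (inj₂ refl)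
                           ∷ outer-newBlocks xs

  ¬outer-lift : ∀ e → ¬ Outer (mapArc lift e)
  ¬outer-lift _       (inj₁ (inj₁ ()))
  ¬outer-lift _       (inj₁ (inj₂ ()))
  ¬outer-lift (_ , j) (inj₂ (inj₁ eq)) = lift≢top₀ j eq
  ¬outer-lift (_ , j) (inj₂ (inj₂ eq)) = lift≢top₁ j eq

  disjoint-lift-newBlocks : ∀ as xs → Disjoint (map (mapArc lift) as) (arcsOf (newBlocks xs))
  disjoint-lift-newBlocks as xs (e∈lifted , e∈new) with ∈-map⁻ (mapArc lift) e∈lifted
  ... | e , _ , refl = ¬outer-lift e (All.lookup (outer-newBlocks xs) e∈new)

  below-lift : ∀ s x → below (2 + s) (lift x) ≡ below s x
  below-lift s x = cong (_<ᵇ 2 + s) (toℕ-lift x)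

  weight-lift : ∀ s e → weight (2 + s) (mapArc lift e) ≡ weight s e
  weight-lift s (i , j) = cong₂ (λ bj bi → indicator bj + indicator (not bi)) (below-lift s j) (below-lift s i)

  blockWeight-lift : ∀ s B → blockWeight (2 + s) (mapBlock lift B) ≡ blockWeight s B
  blockWeight-lift s (e , e′) = cong₂ _+_ (weight-lift s e) (weight-lift s e′)

  module _ {s : ℕ} (s≤n : s ≤ n) where

    below-top₀ : below (2 + s) top₀ ≡ false
    below-top₀ = trans (cong (_<ᵇ 2 + s) toℕ-top₀) (m≤n⇒n<ᵇm≡false s≤n)

    below-top₁ : below (2 + s) top₁ ≡ false
    below-top₁ = trans (cong (_<ᵇ 2 + s) toℕ-top₁) (m≤n⇒n<ᵇm≡false (m≤n⇒m≤1+n s≤n))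

    private
      weight-through : ∀ b → indicator b + 0 + (0 + indicator (not b)) ≡ 1
      weight-through false = refl
      weight-through true  = refl

      tight-chain : ∀ {B : Block (4 + n)} → IsChain B → blockWeight (2 + s) B ≡ 1 →
                    blockWeight (2 + s) B ≤ chainIndicator B
      tight-chain chain w≡1 = ≤-reflexive (trans w≡1 (sym (chainIndicator-chain chain)))

    blockWeight-chain₀ : ∀ x → blockWeight (2 + s) (chain₀ x) ≡ 1
    blockWeight-chain₀ x =
      trans (cong₂ (λ b t → indicator b + 0 + (indicator t + indicator (not b))) (below-lift s x) below-top₀)
            (weight-through (below s x))

    blockWeight-chain₁ : ∀ x → blockWeight (2 + s) (chain₁ x) ≡ 1
    blockWeight-chain₁ x =
      trans (cong₂ (λ b t → indicator b + 0 + (indicator t + indicator (not b))) (below-lift s x) below-top₁)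
            (weight-through (below s x))

    blockWeight-cornerChain₀ : blockWeight (2 + s) cornerChain₀ ≡ 1
    blockWeight-cornerChain₀ = cong (λ t → 1 + (indicator t + 0)) below-top₀

    blockWeight-cornerChain₁ : blockWeight (2 + s) cornerChain₁ ≡ 1
    blockWeight-cornerChain₁ =
      cong₂ (λ t₀ t₁ → indicator t₀ + 0 + (indicator t₁ + indicator (not t₀))) below-top₀ below-top₁

    blockWeight-cornerCollider : blockWeight (2 + s) cornerCollider ≡ 0
    blockWeight-cornerCollider = cong (λ t → indicator t + 0 + (indicator t + 0)) below-top₁

    tight-newBlocks : ∀ xs → All (λ B → blockWeight (2 + s) B ≤ chainIndicator B) (newBlocks xs)
    tight-newBlocks []       = tight-chain isChain-cornerChain₀ blockWeight-cornerChain₀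
                             ∷ tight-chain isChain-cornerChain₁ blockWeight-cornerChain₁
                             ∷ subst (_≤ chainIndicator cornerCollider) (sym blockWeight-cornerCollider) z≤n ∷ []
    tight-newBlocks (x ∷ xs) = tight-chain (isChain-chain₀ x) (blockWeight-chain₀ x)
                             ∷ tight-chain (isChain-chain₁ x) (blockWeight-chain₁ x)
                             ∷ tight-newBlocks xs

  chain₀∈newBlocks : ∀ {x xs} → x ∈ xs → chain₀ x ∈ newBlocks xs
  chain₀∈newBlocks (here refl) = here refl
  chain₀∈newBlocks (there x∈xs) = there (there (chain₀∈newBlocks x∈xs))

  chain₁∈newBlocks : ∀ {x xs} → x ∈ xs → chain₁ x ∈ newBlocks xs
  chain₁∈newBlocks (here refl) = there (here refl)
  chain₁∈newBlocks (there x∈xs) = there (there (chain₁∈newBlocks x∈xs))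

  corner∈newBlocks : ∀ {B} xs → B ∈ corners → B ∈ newBlocks xs
  corner∈newBlocks []       B∈corners = B∈corners
  corner∈newBlocks (x ∷ xs) B∈corners = there (there (corner∈newBlocks xs B∈corners))

  module _ (D : CCFDecomposition n) where

    liftedArcs newArcs : List (Arc (4 + n))
    liftedArcs = map (mapArc lift) (arcsOf (blocks D))
    newArcs    = arcsOf (newBlocks (allFin n))

    private
      new₁ : ∀ {B} → B ∈ newBlocks (allFin n) → proj₁ B ∈ liftedArcs ++ newArcs
      new₁ B∈new = ∈-++⁺ʳ liftedArcs (∈-arcsOf₁ B∈new)

      new₂ : ∀ {B} → B ∈ newBlocks (allFin n) → proj₂ B ∈ liftedArcs ++ newArcs
      new₂ B∈new = ∈-++⁺ʳ liftedArcs (∈-arcsOf₂ B∈new)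

      corner : ∀ {B} → B ∈ corners → B ∈ newBlocks (allFin n)
      corner = corner∈newBlocks (allFin n)

    cover-extension : ∀ {i j} → Position i → Position j → i < j → (i , j) ∈ liftedArcs ++ newArcs
    cover-extension (isLift x) (isLift y) x<y =
      ∈-++⁺ˡ (∈-map⁺ (mapArc lift) (cover D x y (lift-mono⁻¹ x<y)))
    cover-extension isBot₀     isBot₁     _ = new₁ (corner (here refl))
    cover-extension isBot₀     (isLift y) _ = new₁ (chain₀∈newBlocks (∈-allFin y))
    cover-extension isBot₀     isTop₀     _ = new₁ (corner (there (here refl)))
    cover-extension isBot₀     isTop₁     _ = new₁ (corner (there (there (here refl))))
    cover-extension isBot₁     (isLift y) _ = new₁ (chain₁∈newBlocks (∈-allFin y))
    cover-extension isBot₁     isTop₀     _ = new₂ (corner (here refl))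
    cover-extension isBot₁     isTop₁     _ = new₂ (corner (there (there (here refl))))
    cover-extension (isLift x) isTop₀     _ = new₂ (chain₀∈newBlocks (∈-allFin x))
    cover-extension (isLift x) isTop₁     _ = new₂ (chain₁∈newBlocks (∈-allFin x))
    cover-extension isTop₀     isTop₁     _ = new₂ (corner (there (here refl)))
    cover-extension _          isBot₀     ()
    cover-extension isBot₁     isBot₁     (s≤s ())
    cover-extension (isLift _) isBot₁     (s≤s ())
    cover-extension isTop₀     isBot₁     (s≤s ())
    cover-extension isTop₁     isBot₁     (s≤s ())
    cover-extension isTop₀     (isLift y) p = ⊥-elim (<-asym p (lift<top₀ y))
    cover-extension isTop₁     (isLift y) p = ⊥-elim (<-asym p (lift<top₁ y))
    cover-extension isTop₀     isTop₀     p = ⊥-elim (<-irrefl refl p)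
    cover-extension isTop₁     isTop₀     p = ⊥-elim (<-asym p top₀<top₁)
    cover-extension isTop₁     isTop₁     p = ⊥-elim (<-irrefl refl p)

    extendedBlocks : List (Block (4 + n))
    extendedBlocks = map (mapBlock lift) (blocks D) ++ newBlocks (allFin n)

    arcsOf-extendedBlocks : arcsOf extendedBlocks ≡ liftedArcs ++ newArcs
    arcsOf-extendedBlocks = trans (arcsOf-++ (map (mapBlock lift) (blocks D)) (newBlocks (allFin n)))
                                  (cong (_++ newArcs) (arcsOf-map lift (blocks D)))

    extension : CCFDecomposition (4 + n)
    blocks   extension = extendedBlocks
    shape    extension =
      AllP.++⁺ (AllP.map⁺ (All.map (isCCF-map lift-injective) (shape D))) (shape-newBlocks (allFin n))
    valid    extension = subst (All IsArcTT) (sym arcsOf-extendedBlocks)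
      (AllP.++⁺ (AllP.map⁺ (All.map lift-mono (valid D))) (valid-newBlocks (allFin n)))
    distinct extension = subst Unique (sym arcsOf-extendedBlocks)
      (UniqueP.++⁺ (UniqueP.map⁺ mapArc-lift-injective (distinct D))
                   (unique-newBlocks (allFin n) (UniqueP.allFin⁺ n))
                   (disjoint-lift-newBlocks (arcsOf (blocks D)) (allFin n)))
    cover    extension i j i<j =
      subst ((i , j) ∈_) (sym arcsOf-extendedBlocks) (cover-extension (position i) (position j) i<j)

    numChains-extension : numChains extension ≡ numChains D + (n * 2 + 2)
    numChains-extension = begin
      numChains extension                          ≡⟨ numChains≡sum-chainIndicator extension ⟩
      count (lifted ++ new)                        ≡⟨ cong sum (map-++ chainIndicator lifted new) ⟩
      sum (map chainIndicator lifted ++ map chainIndicator new)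
                                                   ≡⟨ sum-++ (map chainIndicator lifted) (map chainIndicator new) ⟩
      count lifted + count new                     ≡⟨ cong₂ _+_ count-lifted (sum-chainIndicator-newBlocks (allFin n)) ⟩
      numChains D + (length (allFin n) * 2 + 2)    ≡⟨ cong (λ l → numChains D + (l * 2 + 2)) (length-tabulate {n = n} id) ⟩
      numChains D + (n * 2 + 2)                    ∎
      where
        open ≡-Reasoning
        count : List (Block (4 + n)) → ℕ
        count bs = sum (map chainIndicator bs)
        lifted new : List (Block (4 + n))
        lifted = map (mapBlock lift) (blocks D)
        new    = newBlocks (allFin n)
        count-lifted : count lifted ≡ numChains D
        count-lifted = begin
          count lifted                                  ≡⟨ cong sum (map-∘ (blocks D)) ⟨
          sum (map (chainIndicator ∘ mapBlock lift) (blocks D))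
                                                        ≡⟨ cong sum (map-cong (chainIndicator-map lift-injective) (blocks D)) ⟩
          sum (map chainIndicator (blocks D))           ≡⟨ numChains≡sum-chainIndicator D ⟨
          numChains D                                   ∎

    tight-extension : ∀ {s} → s ≤ n → Tight s D → Tight (2 + s) extension
    tight-extension {s} s≤n tight =
      AllP.++⁺ (AllP.map⁺ (All.map tight-lift tight)) (tight-newBlocks s≤n (allFin n))
      where
        tight-lift : ∀ {B} → blockWeight s B ≤ chainIndicator B →
                     blockWeight (2 + s) (mapBlock lift B) ≤ chainIndicator (mapBlock lift B)
        tight-lift {B} = subst₂ _≤_ (sym (blockWeight-lift s B)) (sym (chainIndicator-map lift-injective B))

record Extremal (n c : ℕ) : Set where
  field
    decomposition : CCFDecomposition n
    chains        : numChains decomposition ≡ c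
    cut           : ℕ
    cut≤n         : cut ≤ n
    tight         : Tight cut decomposition

open Extremal

extremal⇒maximal : ∀ {n c} → Extremal n c → (D : CCFDecomposition n) → numChains D ≤ c
extremal⇒maximal E D =
  subst (numChains D ≤_) (chains E) (tight⇒maximal {s = cut E} {decomposition E} (tight E) D)

emptyDecomposition : ∀ {n} → n ≤ 1 → CCFDecomposition n
blocks   (emptyDecomposition n≤1) = []
shape    (emptyDecomposition n≤1) = []
valid    (emptyDecomposition n≤1) = []
distinct (emptyDecomposition n≤1) = []
cover    (emptyDecomposition n≤1) i j i<j = ⊥-elim (n≮0 (≤-trans i<j (s≤s⁻¹ (≤-trans (toℕ<n j) n≤1))))

emptyExtremal : ∀ {n} → n ≤ 1 → Extremal n 0
emptyExtremal n≤1 = record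
  { decomposition = emptyDecomposition n≤1 ; chains = refl ; cut = 0 ; cut≤n = z≤n ; tight = [] }

extremal-extension : ∀ {n c} → Extremal n c → Extremal (4 + n) (c + (n * 2 + 2))
extremal-extension {n} E = record
  { decomposition = extension (decomposition E)
  ; chains        = trans (numChains-extension (decomposition E)) (cong (_+ (n * 2 + 2)) (chains E))
  ; cut           = 2 + cut E
  ; cut≤n         = s≤s (s≤s (m≤n⇒m≤1+n (m≤n⇒m≤1+n (cut≤n E))))
  ; tight         = tight-extension (decomposition E) (cut≤n E) (tight E)
  }
  where open Extension n

-- The chain counts satisfy 4c = n² − 2n + r, stated without subtraction.
chainCount-step : ∀ n c r → c * 4 + n * 2 ≡ n * n + r →
                  (c + (n * 2 + 2)) * 4 + (4 + n) * 2 ≡ (4 + n) * (4 + n) + r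
chainCount-step n c r hyp = begin
  (c + (n * 2 + 2)) * 4 + (4 + n) * 2 ≡⟨ expand n c ⟩
  (c * 4 + n * 2) + (n * 8 + 16)      ≡⟨ cong (_+ (n * 8 + 16)) hyp ⟩
  (n * n + r) + (n * 8 + 16)          ≡⟨ square n r ⟩
  (4 + n) * (4 + n) + r               ∎
  where
    open ≡-Reasoning
    expand : ∀ n c → (c + (n * 2 + 2)) * 4 + (4 + n) * 2 ≡ (c * 4 + n * 2) + (n * 8 + 16)
    expand = solve-∀
    square : ∀ n r → (n * n + r) + (n * 8 + 16) ≡ (4 + n) * (4 + n) + r
    square = solve-∀

extremal-q*4+r : ∀ {r} → r ≤ 1 → ∀ q → let n = q * 4 + r in
                 Σ ℕ λ c → (c * 4 + n * 2 ≡ n * n + r) × Extremal n c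
extremal-q*4+r r≤1 zero = 0 , base-identity r≤1 , emptyExtremal r≤1
  where
    base-identity : ∀ {r} → r ≤ 1 → r * 2 ≡ r * r + r
    base-identity z≤n       = refl
    base-identity (s≤s z≤n) = refl
extremal-q*4+r {r} r≤1 (suc q) with extremal-q*4+r r≤1 q
... | c , identity , E =
  c + ((q * 4 + r) * 2 + 2) , chainCount-step (q * 4 + r) c r identity , extremal-extension E

maxChains-even : ∀ n {c} → c * 4 + n * 2 ≡ n * n + 0 → c ≡ n * (n ∸ 2) / 4
maxChains-even n {c} identity = sym (begin
  n * (n ∸ 2) / 4               ≡⟨ cong (_/ 4) (*-distribˡ-∸ n n 2) ⟩
  (n * n ∸ n * 2) / 4           ≡⟨ cong (λ m → (m ∸ n * 2) / 4) (trans identity (+-identityʳ (n * n))) ⟨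
  (c * 4 + n * 2 ∸ n * 2) / 4   ≡⟨ cong (_/ 4) (m+n∸n≡m (c * 4) (n * 2)) ⟩
  c * 4 / 4                     ≡⟨ m*n/n≡m c 4 ⟩
  c                             ∎)
  where open ≡-Reasoning

maxChains-odd : ∀ n {c} → 1 ≤ n → c * 4 + n * 2 ≡ n * n + 1 → c ≡ (n ∸ 1) * (n ∸ 1) / 4
maxChains-odd (suc k) {c} _ identity = sym (begin
  k * k / 4  ≡⟨ cong (_/ 4) (+-cancelʳ-≡ (k * 2 + 2) (c * 4) (k * k) cancelled) ⟨
  c * 4 / 4  ≡⟨ m*n/n≡m c 4 ⟩
  c          ∎)
  where
    open ≡-Reasoning
    square : ∀ k → suc k * suc k + 1 ≡ k * k + (k * 2 + 2)
    square = solve-∀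
    cancelled : c * 4 + (k * 2 + 2) ≡ k * k + (k * 2 + 2)
    cancelled = begin
      c * 4 + (k * 2 + 2)     ≡⟨ cong (c * 4 +_) (+-comm (k * 2) 2) ⟩
      c * 4 + suc k * 2       ≡⟨ identity ⟩
      suc k * suc k + 1       ≡⟨ square k ⟩
      k * k + (k * 2 + 2)     ∎

n%4≤1⇒n%4≡n%2 : ∀ n → n % 4 ≤ 1 → n % 4 ≡ n % 2
n%4≤1⇒n%4≡n%2 n r≤1 = trans (sym (m<n⇒m%n≡m (s≤s r≤1))) (m∣n⇒o%n%m≡o%m 2 4 n (divides 2 refl))

extremal-mod4 : ∀ n → n % 4 ≤ 1 → Σ ℕ λ c → (c * 4 + n * 2 ≡ n * n + n % 2) × Extremal n c
extremal-mod4 n r≤1 =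
  let c , identity , E = subst Goal n/4*4+n%4≡n (extremal-q*4+r r≤1 (n / 4))
  in  c , trans identity (cong (n * n +_) (n%4≤1⇒n%4≡n%2 n r≤1)) , E
  where
    Goal : ℕ → Set
    Goal m = Σ ℕ λ c → (c * 4 + m * 2 ≡ m * m + n % 4) × Extremal m c
    n/4*4+n%4≡n : n / 4 * 4 + n % 4 ≡ n
    n/4*4+n%4≡n = trans (+-comm (n / 4 * 4) (n % 4)) (sym (m≡m%n+[m/n]*n n 4))

mainTheorem4 : (n : ℕ) → 1 ≤ n → (n % 4 ≡ 0 ⊎ n % 4 ≡ 1) →
    Σ ℕ (λ M →
      ((n % 2 ≡ 0 → M ≡ (n * (n ∸ 2)) / 4) × (n % 2 ≡ 1 → M ≡ ((n ∸ 1) * (n ∸ 1)) / 4))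
      × Σ (CCFDecomposition n) (λ D → numChains D ≡ M)
      × ((D : CCFDecomposition n) → numChains D ≤ M))
mainTheorem4 n 1≤n n%4≡0∨1 =
  let c , identity , E = extremal-mod4 n n%4≤1
  in  c
    , ( (λ n%2≡0 → maxChains-even n (trans identity (cong (n * n +_) n%2≡0)))
      , (λ n%2≡1 → maxChains-odd n 1≤n (trans identity (cong (n * n +_) n%2≡1))))
    , (decomposition E , chains E)
    , extremal⇒maximal E
  where
    n%4≤1 : n % 4 ≤ 1
    n%4≤1 = [ (λ n%4≡0 → subst (_≤ 1) (sym n%4≡0) z≤n) , ≤-reflexive ] n%4≡0∨1
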